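{- Let $S$ and $T$ be monads on $\mathsf{Set}$ and let $\lambda \colon TS \Rightarrow ST$ be a natural transformation satisfying either $\lambda \circ T\eta^S = \eta^S T$ or $\lambda \circ \eta^T S = S\eta^T$. Then $$\lambda E \circ T\epsilon^S \circ \epsilon^T S = S\epsilon^T \circ \epsilon^S T \circ E\lambda,$$ where $E$ is the exception monad and $\epsilon^S, \epsilon^T$ are defined below.
   Context: The exception monad $E$ on $\mathsf{Set}$: $EX = X + 1$ with $1=\{*\}$, coproduct injections $\mathsf{inl}_X \colon X \to X+1$, $\mathsf{inr}_X \colon 1 \to X+1$; $Ef$ acts as $f$ on the left summand and fixes $*$; unit $\eta^E = \mathsf{inl}$; multiplication $\mu^E_X(\mathsf{inl}(z)) = z$, $\mu^E_X(\mathsf{inr}(*)) = \mathsf{inr}(*)$. For any monad $T$ on $\mathsf{Set}$, $\epsilon^T \colon ET \Rightarrow TE$ is the natural transformation determined by $\epsilon^T_X(\mathsf{inl}(t)) = T(\mathsf{inl}_X)(t)$ for $t \in TX$ and $\epsilon^T_X(\mathsf{inr}(*)) = \eta^T_{EX}(\mathsf{inr}_X(*))$ (i.e. $\epsilon^T \circ \mathsf{inl}T = T\eta^E$ and $\epsilon^T \circ \mathsf{inr}T = \eta^T E \circ \mathsf{inr}$). -}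

module Defs where

open import Data.Sum using (_⊎_; inj₁; inj₂)
open import Data.Unit using (⊤; tt)
open import Function using (_∘_; id)
open import Relation.Binary.PropositionalEquality using (_≡_)

-- A monad on Set (Set₀): endofunctor with unit and multiplication,
-- all equations of natural transformations / laws stated pointwise
-- (no function extensionality available).
record Monad : Set₁ where
  field
    F     : Set → Set
    map   : {X Y : Set} → (X → Y) → F X → F Y
    η     : {X : Set} → X → F X
    μ     : {X : Set} → F (F X) → F X
    map-id : {X : Set} (x : F X) → map id x ≡ x
    map-∘  : {X Y Z : Set} (g : Y → Z) (f : X → Y) (x : F X) →
             map (g ∘ f) x ≡ map g (map f x)
    η-natural : {X Y : Set} (f : X → Y) (x : X) → map f (η x) ≡ η (f x)
    μ-natural : {X Y : Set} (f : X → Y) (x : F (F X)) →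
                map f (μ x) ≡ μ (map (map f) x)
    μ-η-left  : {X : Set} (x : F X) → μ (η x) ≡ x
    μ-η-right : {X : Set} (x : F X) → μ (map η x) ≡ x
    μ-assoc   : {X : Set} (x : F (F (F X))) → μ (μ x) ≡ μ (map μ x)

open Monad public

E : Set → Set
E X = X ⊎ ⊤

mapE : {X Y : Set} → (X → Y) → E X → E Y
mapE f (inj₁ x) = inj₁ (f x)
mapE f (inj₂ t) = inj₂ t

ε : (T : Monad) → {X : Set} → E (F T X) → F T (E X)
ε T (inj₁ t)  = map T inj₁ t
ε T (inj₂ tt) = η T (inj₂ tt)

record NatTrans (T S : Monad) : Set₁ where
  field
    component : {X : Set} → F T (F S X) → F S (F T X)
    natural   : {X Y : Set} (f : X → Y) (x : F T (F S X)) →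
                component (map T (map S f) x) ≡ map S (map T f) (component x)

open NatTrans public

{-# OPTIONS --safe #-}

-- On inl both sides are λ followed by inl, so naturality of λ suffices; on inr both
-- sides collapse to units at the exception, and either unit law makes λ carry the
-- composite unit of T S to that of S T.
module Submission where

open import Defs
open import Data.Sum using (_⊎_; inj₁; inj₂)
open import Data.Unit using (tt)
open import Relation.Binary.PropositionalEquality using (_≡_; refl; sym; cong; module ≡-Reasoning)

open ≡-Reasoning

ε-λ-commute-inj₁ : (S T : Monad) (lam : NatTrans T S) {X : Set} (t : F T (F S X)) →
  component lam (map T (ε S) (ε T (inj₁ t))) ≡ map S (ε T) (ε S (inj₁ (component lam t)))
ε-λ-commute-inj₁ S T lam t = begin
  component lam (map T (ε S) (map T inj₁ t))  ≡⟨ cong (component lam) (map-∘ T (ε S) inj₁ t) ⟨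
  component lam (map T (map S inj₁) t)        ≡⟨ natural lam inj₁ t ⟩
  map S (map T inj₁) (component lam t)        ≡⟨ map-∘ S (ε T) inj₁ (component lam t) ⟩
  map S (ε T) (map S inj₁ (component lam t))  ∎

λ-ηη-from-Sη : (S T : Monad) (lam : NatTrans T S) →
  (∀ {X : Set} (t : F T X) → component lam (map T (η S) t) ≡ η S t) →
  ∀ {X : Set} (x : X) → component lam (η T (η S x)) ≡ η S (η T x)
λ-ηη-from-Sη S T lam unitˢ x = begin
  component lam (η T (η S x))        ≡⟨ cong (component lam) (η-natural T (η S) x) ⟨
  component lam (map T (η S) (η T x)) ≡⟨ unitˢ (η T x) ⟩
  η S (η T x)                         ∎

λ-ηη-from-Tη : (S T : Monad) (lam : NatTrans T S) →
  (∀ {X : Set} (s : F S X) → component lam (η T s) ≡ map S (η T) s) →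
  ∀ {X : Set} (x : X) → component lam (η T (η S x)) ≡ η S (η T x)
λ-ηη-from-Tη S T lam unitᵀ x = begin
  component lam (η T (η S x)) ≡⟨ unitᵀ (η S x) ⟩
  map S (η T) (η S x)         ≡⟨ η-natural S (η T) x ⟩
  η S (η T x)                 ∎

ε-λ-commute-inj₂ : (S T : Monad) (lam : NatTrans T S) →
  (∀ {X : Set} (x : X) → component lam (η T (η S x)) ≡ η S (η T x)) →
  ∀ {X : Set} → component lam (map T (ε S) (ε T (inj₂ tt)))
                  ≡ map S (ε T) (ε S {F T X} (inj₂ tt))
ε-λ-commute-inj₂ S T lam unitˢᵀ {X} = begin
  component lam (map T (ε S) (η T (inj₂ tt))) ≡⟨ cong (component lam) (η-natural T (ε S) (inj₂ tt)) ⟩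
  component lam (η T (η S (inj₂ tt)))         ≡⟨ unitˢᵀ (inj₂ tt) ⟩
  η S (η T (inj₂ tt))                         ≡⟨ η-natural S (ε T) (inj₂ tt) ⟨
  map S (ε T) (η S (inj₂ tt))                 ∎

proposition4p9 : (S T : Monad) (lam : NatTrans T S) →
    ((∀ {X : Set} (t : F T X) → component lam (map T (η S) t) ≡ η S t)
      ⊎ (∀ {X : Set} (s : F S X) → component lam (η T s) ≡ map S (η T) s)) →
    ∀ {X : Set} (x : E (F T (F S X))) →
      component lam (map T (ε S) (ε T x)) ≡ map S (ε T) (ε S (mapE (component lam) x))
proposition4p9 S T lam _ (inj₁ t) = ε-λ-commute-inj₁ S T lam t
proposition4p9 S T lam (inj₁ unitˢ) (inj₂ tt) =
  ε-λ-commute-inj₂ S T lam (λ-ηη-from-Sη S T lam unitˢ)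
proposition4p9 S T lam (inj₂ unitᵀ) (inj₂ tt) =
  ε-λ-commute-inj₂ S T lam (λ-ηη-from-Tη S T lam unitᵀ)
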